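{- Let $p$ be a pattern of length $k$ with doubling number $t$ and $q$ a pattern of length $k'$ with doubling number $t'$. If $\lceil (k+t)/2\rceil\ne\lceil (k'+t')/2\rceil$, then there is an even $n$ with $|A_n(p)|\neq|A_n(q)|$. If $\lceil (k+t-1)/2\rceil\ne\lceil (k'+t'-1)/2\rceil$, then there is an odd $n$ with $|A_n(p)|\ne|A_n(q)|$.
   Context: A permutation $w\in S_n$ is alternating if $w_1<w_2>w_3<\cdots$; $A_n(q)$ is the set of alternating permutations of length $n$ avoiding $q$ (having no subsequence order-isomorphic to $q$). For $p=p_1\cdots p_k$, set $p_0=\infty$ and define $d(p)=\{i\in[k-1]: p_{i-1}>p_i>p_{i+1}\text{ or }p_{i-1}<p_i<p_{i+1}\}$; the doubling number of $p$ is $|d(p)|$. -}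

module Defs where

open import Data.Nat using (ℕ; zero; suc; _+_; _*_; _∸_; _<_; _>_; ⌈_/2⌉)
open import Data.List using (List; []; _∷_; length; upTo; lookup)
open import Data.List.Relation.Binary.Permutation.Propositional using (_↭_)
open import Data.List.Relation.Binary.Sublist.Propositional using (_⊆_)
open import Data.List.Relation.Unary.Unique.Propositional using (Unique)
open import Data.List.Membership.Propositional using (_∈_)
open import Data.Maybe using (Maybe; just; nothing)
open import Data.Fin using (Fin)
open import Data.Unit using (⊤)
open import Data.Product using (_×_; ∃-syntax)
open import Data.Empty using (⊥)
open import Relation.Nullary using (¬_; Dec; yes; no)
open import Relation.Binary.PropositionalEquality using (_≡_)
open import Function.Bundles using (_⇔_)

-- Permutations are lists of naturals; a permutation of length n is a
-- rearrangement of 0,1,...,n-1 (values 0-based; pattern notions are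
-- order-invariant so this is harmless).
IsPerm : List ℕ → Set
IsPerm w = w ↭ upTo (length w)

InS : ℕ → List ℕ → Set
InS n w = w ↭ upTo n

mutual
  Up : List ℕ → Set
  Up []            = ⊤
  Up (x ∷ [])      = ⊤
  Up (x ∷ y ∷ r)   = x < y × Down (y ∷ r)

  Down : List ℕ → Set
  Down []          = ⊤
  Down (x ∷ [])    = ⊤
  Down (x ∷ y ∷ r) = x > y × Up (y ∷ r)

Alternating : List ℕ → Set
Alternating = Up

OrderIso : List ℕ → List ℕ → Set
OrderIso s q = Σ-len
  where
  open import Data.Product using (Σ)
  Σ-len : Set
  Σ-len = Σ (length s ≡ length q) λ e →
            (i j : Fin (length s)) →
            (lookup s i < lookup s j) ⇔
            (lookup q (Data.Fin.cast e i) < lookup q (Data.Fin.cast e j))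

Contains : List ℕ → List ℕ → Set
Contains w q = ∃[ s ] (s ⊆ w × OrderIso s q)

Avoids : List ℕ → List ℕ → Set
Avoids w q = ¬ Contains w q

InA : ℕ → List ℕ → List ℕ → Set
InA n q w = InS n w × Alternating w × Avoids w q

CardA : ℕ → List ℕ → ℕ → Set
CardA n q m = ∃[ L ] (Unique L × (∀ w → (w ∈ L) ⇔ InA n q w) × length L ≡ m)

-- ∞-extended comparison (nothing = ∞)
_<∞_ : Maybe ℕ → Maybe ℕ → Set
just x  <∞ just y  = x < y
just x  <∞ nothing = ⊤
nothing <∞ _       = ⊥

Monotone : Maybe ℕ → Maybe ℕ → Maybe ℕ → Set
Monotone a b c = ((b <∞ a) × (c <∞ b)) Data.Sum.⊎ ((a <∞ b) × (b <∞ c))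
  where import Data.Sum

monotone? : (a b c : Maybe ℕ) → Dec (Monotone a b c)
monotone? a b c = dec-or (dec-and (lt? b a) (lt? c b)) (dec-and (lt? a b) (lt? b c))
  where
  open import Data.Sum using (_⊎_; inj₁; inj₂)
  open import Data.Product using (_,_; proj₁; proj₂)
  open import Data.Nat using (_<?_)
  lt? : (x y : Maybe ℕ) → Dec (x <∞ y)
  lt? (just x) (just y) = x <? y
  lt? (just x) nothing  = yes Data.Unit.tt
  lt? nothing  _        = no (λ ())
  dec-and : {P Q : Set} → Dec P → Dec Q → Dec (P × Q)
  dec-and (yes p) (yes q) = yes (p , q)
  dec-and (no ¬p) _       = no (λ pq → ¬p (proj₁ pq))
  dec-and (yes _) (no ¬q) = no (λ pq → ¬q (proj₂ pq))
  dec-or : {P Q : Set} → Dec P → Dec Q → Dec (P ⊎ Q)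
  dec-or (yes p) _       = yes (inj₁ p)
  dec-or (no _) (yes q)  = yes (inj₂ q)
  dec-or (no ¬p) (no ¬q) = no λ { (inj₁ p) → ¬p p ; (inj₂ q) → ¬q q }

countMono : List (Maybe ℕ) → ℕ
countMono (a ∷ r@(b ∷ c ∷ _)) = ind (monotone? a b c) + countMono r
  where
  ind : {P : Set} → Dec P → ℕ
  ind (yes _) = 1
  ind (no _)  = 0
countMono _ = 0

-- doubling number |d(p)|: with p₀ = ∞, count i ∈ [k-1] such that
-- (p_{i-1}, p_i, p_{i+1}) is monotone; these are exactly the consecutive
-- triples of the sequence ∞, p₁, …, p_k.
doubling : List ℕ → ℕ
doubling p = countMono (nothing ∷ Data.List.map just p)

module Submission where

-- The key quantity is ℓ(p) = |p| + t(p), the least length of an alternating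
-- permutation containing p:
--  * lower-bound: an alternating w containing p has at least ℓ(p) entries,
--    since each doubled position of p forces an extra entry of w (run-bound,
--    a telescoping count along an occurrence of p in w);
--  * witness: for N = ℓ(p) and N = ℓ(p) + 1 some alternating permutation of
--    length N contains p: write the entries x of p as centres 3x+1, insert a
--    detour 3x or 3x+2 after each doubled position (and possibly at the end)
--    and standardise the result by ranks.
-- So if N ∈ {ℓ(p), ℓ(p)+1} and N < ℓ(q), all alternating permutations of
-- length N avoid q while one contains p, whence |A_N(p)| < |A_N(q)|
-- (separating-length).  The least even (odd) length ≥ ℓ is 2⌈ℓ/2⌉
-- (1 + 2⌈(ℓ-1)/2⌉), which yields the corollary.

open import Defs
open import Data.Bool using (Bool; true; false; not)
open import Data.Bool.Properties using (T-≡; not-involutive)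
open import Data.Maybe using (Maybe; just; nothing)
open import Data.Maybe.Properties using (just-injective)
open import Data.Nat using (ℕ; zero; suc; _+_; _*_; _∸_; _≤_; _<_; z≤n; s≤s; _<?_; _<ᵇ_; ⌈_/2⌉; s≤s⁻¹)
open import Data.Nat.Tactic.RingSolver using (solve-∀)
open import Data.Nat.DivMod using (_/_; +-distrib-/-∣ˡ; m*n/n≡m; m<n⇒m/n≡0)
open import Data.Nat.Divisibility using (n∣m*n)
open import Data.Nat.Properties
open import Data.List using (List; []; _∷_; length; upTo; map; _++_; lookup)
open import Data.List.Properties using (length-map; length-upTo; length-++; length-++-sucʳ; map-∘)
open import Data.List.Membership.Propositional using (_∈_; _∉_)
open import Data.List.Membership.Propositional.Properties
  using (∈-++⁻; ∈-++⁺ˡ; ∈-++⁺ʳ; ∈-∃++; ∈-upTo⁺; ∈-lookup; ∈-map⁺; ∈-map⁻)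
open import Data.List.Membership.DecPropositional _≟_ using (_∈?_)
open import Data.List.Membership.Setoid.Properties using (unique⇒irrelevant)
open import Data.List.Relation.Unary.Any using (here; there)
open import Data.List.Relation.Unary.All using ([]; _∷_)
open import Data.List.Relation.Unary.All.Properties using (¬Any⇒All¬)
open import Data.List.Relation.Unary.Unique.Propositional using (Unique; []; _∷_)
open import Data.List.Relation.Unary.Unique.Propositional.Properties using (upTo⁺; Unique[x∷xs]⇒x∉xs)
open import Data.List.Relation.Binary.Permutation.Propositional using (_↭_; ↭-refl; ↭-sym; ↭⇒↭ₛ)
open import Data.List.Relation.Binary.Permutation.Propositional.Properties using (↭-length)
open import Data.List.Relation.Binary.Permutation.Setoid.Properties using (Unique-resp-↭)
open import Data.List.Relation.Binary.Sublist.Propositional using (_⊆_; []; _∷ʳ_; _∷_; minimum) renaming (lookup to ⊆-lookup)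
open import Data.List.Relation.Binary.Sublist.Propositional.Properties using (map⁺)
open import Data.List.Relation.Binary.BagAndSetEquality using (∼bag⇒↭)
open import Data.Fin using (zero; suc; cast)
open import Data.Product using (_×_; _,_; proj₁; proj₂; ∃-syntax)
open import Data.Sum using (inj₁; inj₂)
open import Data.Unit using (⊤; tt)
open import Function using (_∘_)
open import Function.Bundles using (_⇔_; mk⇔; mk↔ₛ′; Equivalence)
open import Function.Properties.Equivalence using () renaming (sym to ⇔-sym)
open Equivalence using (to; from)
open import Relation.Nullary using (¬_; yes; no; contradiction)
open import Relation.Nullary.Reflects using (ofʸ; ofⁿ)
open import Relation.Binary.Definitions using (tri<; tri≈; tri>)
open import Relation.Binary.PropositionalEquality
  using (_≡_; _≢_; refl; sym; trans; cong; cong₂; subst; subst₂; setoid; ≢-sym; module ≡-Reasoning)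

∈-remove : ∀ {A : Set} {x a : A} us {vs} → x ∈ us ++ a ∷ vs → x ≢ a → x ∈ us ++ vs
∈-remove us x∈ x≢a with ∈-++⁻ us x∈
... | inj₁ x∈us        = ∈-++⁺ˡ x∈us
... | inj₂ (here x≡a)  = contradiction x≡a x≢a
... | inj₂ (there x∈vs) = ∈-++⁺ʳ us x∈vs

unique-length-≤ : ∀ {T : Set} (A B : List T) → Unique A → (∀ {x} → x ∈ A → x ∈ B) →
                  length A ≤ length B
unique-length-≤ []      B _          _   = z≤n
unique-length-≤ (a ∷ A) B uaA@(_ ∷ uA) A⊆B with ∈-∃++ (A⊆B (here refl))
... | us , vs , refl = begin
  suc (length A)           ≤⟨ s≤s (unique-length-≤ A (us ++ vs) uA A⊆us++vs) ⟩
  suc (length (us ++ vs))  ≡⟨ length-++-sucʳ us a vs ⟨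
  length (us ++ a ∷ vs)    ∎
  where
  open ≤-Reasoning
  a∉A : a ∉ A
  a∉A = Unique[x∷xs]⇒x∉xs uaA
  A⊆us++vs : ∀ {x} → x ∈ A → x ∈ us ++ vs
  A⊆us++vs x∈A = ∈-remove us (A⊆B (there x∈A)) λ { refl → a∉A x∈A }

unique-length-< : ∀ {T : Set} (A B : List T) → Unique A → (∀ {x} → x ∈ A → x ∈ B) →
                  ∀ {b} → b ∈ B → b ∉ A → length A < length B
unique-length-< A B uA A⊆B b∈B b∉A =
  unique-length-≤ (_ ∷ A) B (¬Any⇒All¬ A b∉A ∷ uA) λ { (here refl) → b∈B ; (there x∈A) → A⊆B x∈A }

-- Two duplicate-free lists with the same members are permutations of each
-- other (membership proofs are unique, so they are bag equivalent).
unique-↭ : {xs ys : List ℕ} → Unique xs → Unique ys →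
           (∀ {x} → x ∈ xs → x ∈ ys) → (∀ {x} → x ∈ ys → x ∈ xs) → xs ↭ ys
unique-↭ uxs uys xs⊆ys ys⊆xs =
  ∼bag⇒↭ (mk↔ₛ′ xs⊆ys ys⊆xs (λ _ → irrelevant uys _ _) (λ _ → irrelevant uxs _ _))
  where irrelevant = unique⇒irrelevant (setoid ℕ) ≡-irrelevant

unique-below⇒↭upTo : ∀ n (xs : List ℕ) → Unique xs → (∀ {x} → x ∈ xs → x < n) →
                     length xs ≡ n → xs ↭ upTo n
unique-below⇒↭upTo n xs uxs below len = unique-↭ uxs (upTo⁺ n) (∈-upTo⁺ ∘ below) covered
  where
  covered : ∀ {x} → x ∈ upTo n → x ∈ xs
  covered {x} x∈upTo with x ∈? xs
  ... | yes x∈xs = x∈xs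
  ... | no  x∉xs = contradiction
    (subst₂ _<_ len (length-upTo n) (unique-length-< xs (upTo n) uxs (∈-upTo⁺ ∘ below) x∈upTo x∉xs))
    (<-irrefl refl)

perm-unique : ∀ {n} {w : List ℕ} → InS n w → Unique w
perm-unique {n} w↭ = Unique-resp-↭ (setoid ℕ) (↭⇒↭ₛ (↭-sym w↭)) (upTo⁺ n)

IncreasingOn : (ℕ → ℕ) → List ℕ → Set
IncreasingOn f S = ∀ {y z} → y ∈ S → z ∈ S → y < z → f y < f z

increasing-tail : ∀ {f x xs} → IncreasingOn f (x ∷ xs) → IncreasingOn f xs
increasing-tail f↑ y∈ z∈ = f↑ (there y∈) (there z∈)

increasing-∘ : ∀ {f h S T} → IncreasingOn f S → IncreasingOn h T →
               (∀ {x} → x ∈ S → f x ∈ T) → IncreasingOn (h ∘ f) S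
increasing-∘ f↑ h↑ f∈ y∈ z∈ = h↑ (f∈ y∈) (f∈ z∈) ∘ f↑ y∈ z∈

increasing-reflects : ∀ {f S y z} → IncreasingOn f S → y ∈ S → z ∈ S → f y < f z → y < z
increasing-reflects {y = y} {z} f↑ y∈ z∈ fy<fz with <-cmp y z
... | tri< y<z _ _  = y<z
... | tri≈ _ refl _ = contradiction fy<fz (<-irrefl refl)
... | tri> _ _ z<y  = contradiction fy<fz (<-asym (f↑ z∈ y∈ z<y))

increasing-injective : ∀ {f S y z} → IncreasingOn f S → y ∈ S → z ∈ S → f y ≡ f z → y ≡ z
increasing-injective {y = y} {z} f↑ y∈ z∈ fy≡fz with <-cmp y z
... | tri< y<z _ _ = contradiction fy≡fz (<⇒≢ (f↑ y∈ z∈ y<z))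
... | tri≈ _ y≡z _ = y≡z
... | tri> _ _ z<y = contradiction (sym fy≡fz) (<⇒≢ (f↑ z∈ y∈ z<y))

unique-map : ∀ {f} xs → IncreasingOn f xs → Unique xs → Unique (map f xs)
unique-map []       _  []               = []
unique-map {f} (x ∷ xs) f↑ ux∷xs@(_ ∷ uxs) =
  ¬Any⇒All¬ (map f xs) fx∉ ∷ unique-map xs (increasing-tail f↑) uxs
  where
  fx∉ : f x ∉ map f xs
  fx∉ fx∈ with ∈-map⁻ f fx∈
  ... | y , y∈xs , fx≡fy = Unique[x∷xs]⇒x∉xs ux∷xs
    (subst (_∈ xs) (sym (increasing-injective f↑ (here refl) (there y∈xs) fx≡fy)) y∈xs)

lookup-map : ∀ (f : ℕ → ℕ) xs i (e : length (map f xs) ≡ length xs) →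
             lookup (map f xs) i ≡ f (lookup xs (cast e i))
lookup-map f (x ∷ xs) zero    e = refl
lookup-map f (x ∷ xs) (suc i) e = lookup-map f xs i (suc-injective e)

increasing-iso : ∀ {f} s → IncreasingOn f s → OrderIso (map f s) s
increasing-iso {f} s f↑ = e , λ i j →
  subst₂ (λ a b → (a < b) ⇔ (lookup s (cast e i) < lookup s (cast e j)))
         (sym (lookup-map f s i e)) (sym (lookup-map f s j e))
         (mk⇔ (increasing-reflects f↑ (∈-lookup _) (∈-lookup _)) (f↑ (∈-lookup _) (∈-lookup _)))
  where e = length-map f s

Step : Bool → ℕ → ℕ → Set
Step true  x y = x < y
Step false x y = y < x

Alt : Bool → List ℕ → Set
Alt b []          = ⊤
Alt b (x ∷ [])    = ⊤
Alt b (x ∷ y ∷ r) = Step b x y × Alt (not b) (y ∷ r)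

mutual
  up⇒alt : ∀ w → Up w → Alt true w
  up⇒alt []          _         = tt
  up⇒alt (x ∷ [])    _         = tt
  up⇒alt (x ∷ y ∷ r) (x<y , d) = x<y , down⇒alt (y ∷ r) d

  down⇒alt : ∀ w → Down w → Alt false w
  down⇒alt []          _         = tt
  down⇒alt (x ∷ [])    _         = tt
  down⇒alt (x ∷ y ∷ r) (y<x , u) = y<x , up⇒alt (y ∷ r) u

mutual
  alt⇒up : ∀ w → Alt true w → Up w
  alt⇒up []          _         = tt
  alt⇒up (x ∷ [])    _         = tt
  alt⇒up (x ∷ y ∷ r) (x<y , d) = x<y , alt⇒down (y ∷ r) d

  alt⇒down : ∀ w → Alt false w → Down w
  alt⇒down []          _         = tt
  alt⇒down (x ∷ [])    _         = tt
  alt⇒down (x ∷ y ∷ r) (y<x , u) = y<x , alt⇒up (y ∷ r) u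

alt-tail : ∀ b x r → Alt b (x ∷ r) → Alt (not b) r
alt-tail b x []      _       = tt
alt-tail b x (y ∷ r) (_ , a) = a

step-map : ∀ {f S x y} b → IncreasingOn f S → x ∈ S → y ∈ S → Step b x y → Step b (f x) (f y)
step-map true  f↑ x∈ y∈ x<y = f↑ x∈ y∈ x<y
step-map false f↑ x∈ y∈ y<x = f↑ y∈ x∈ y<x

alt-map : ∀ {f} b xs → IncreasingOn f xs → Alt b xs → Alt b (map f xs)
alt-map b []          _  _       = tt
alt-map b (x ∷ [])    _  _       = tt
alt-map b (x ∷ y ∷ r) f↑ (s , a) =
  step-map b f↑ (here refl) (there (here refl)) s , alt-map (not b) (y ∷ r) (increasing-tail f↑) a

rank : List ℕ → ℕ → ℕ
rank []      z = 0
rank (u ∷ v) z with u <? z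
... | yes _ = suc (rank v z)
... | no  _ = rank v z

rank-mono : ∀ v {y z} → y ≤ z → rank v y ≤ rank v z
rank-mono []      y≤z = z≤n
rank-mono (u ∷ v) {y} {z} y≤z with u <? y | u <? z
... | yes _   | yes _   = s≤s (rank-mono v y≤z)
... | yes u<y | no  u≮z = contradiction (<-≤-trans u<y y≤z) u≮z
... | no  _   | yes _   = m≤n⇒m≤1+n (rank-mono v y≤z)
... | no  _   | no  _   = rank-mono v y≤z

rank-strict : ∀ v {y z} → y ∈ v → y < z → rank v y < rank v z
rank-strict (u ∷ v) {y} {z} y∈ y<z with u <? y | u <? z | y∈
... | yes u<u | yes _   | here refl = contradiction u<u (<-irrefl refl)
... | yes _   | yes _   | there y∈v = s≤s (rank-strict v y∈v y<z)
... | yes u<y | no  u≮z | _         = contradiction (<-trans u<y y<z) u≮z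
... | no  _   | yes _   | _         = s≤s (rank-mono v (<⇒≤ y<z))
... | no  _   | no  u≮z | here refl = contradiction y<z u≮z
... | no  _   | no  _   | there y∈v = rank-strict v y∈v y<z

rank-increasing : ∀ v → IncreasingOn (rank v) v
rank-increasing v y∈ _ = rank-strict v y∈

rank-≤ : ∀ v z → rank v z ≤ length v
rank-≤ []      z = z≤n
rank-≤ (u ∷ v) z with u <? z
... | yes _ = s≤s (rank-≤ v z)
... | no  _ = m≤n⇒m≤1+n (rank-≤ v z)

rank-< : ∀ v {z} → z ∈ v → rank v z < length v
rank-< (u ∷ v) {z} z∈ with u <? z | z∈
... | yes u<u | here refl = contradiction u<u (<-irrefl refl)
... | no  _   | here refl = s≤s (rank-≤ v u)
... | yes _   | there z∈v = s≤s (rank-< v z∈v)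
... | no  _   | there z∈v = m≤n⇒m≤1+n (rank-< v z∈v)

standardise : ∀ w → Unique w → InS (length w) (map (rank w) w)
standardise w uw = unique-below⇒↭upTo (length w) (map (rank w) w)
  (unique-map w (rank-increasing w) uw) below (length-map (rank w) w)
  where
  below : ∀ {x} → x ∈ map (rank w) w → x < length w
  below x∈ with ∈-map⁻ (rank w) x∈
  ... | z , z∈w , refl = rank-< w z∈w

-- Sequences over ℕ ∪ {∞} of equal length whose consecutive entries compare
-- the same way.  The doubling number only sees these comparisons.
data SameSteps : List (Maybe ℕ) → List (Maybe ℕ) → Set where
  []   : SameSteps [] []
  [-]  : ∀ {a b} → SameSteps (a ∷ []) (b ∷ [])
  step : ∀ {a a′ b b′ u v} → (a <∞ a′ ⇔ b <∞ b′) → (a′ <∞ a ⇔ b′ <∞ b) →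
         SameSteps (a′ ∷ u) (b′ ∷ v) → SameSteps (a ∷ a′ ∷ u) (b ∷ b′ ∷ v)

monotone-transport : ∀ {a a′ a″ b b′ b″} →
  (a <∞ a′ ⇔ b <∞ b′) → (a′ <∞ a ⇔ b′ <∞ b) → (a′ <∞ a″ ⇔ b′ <∞ b″) → (a″ <∞ a′ ⇔ b″ <∞ b′) →
  Monotone a a′ a″ → Monotone b b′ b″
monotone-transport _  e₂ _  e₄ (inj₁ (a′<a , a″<a′)) = inj₁ (to e₂ a′<a , to e₄ a″<a′)
monotone-transport e₁ _  e₃ _  (inj₂ (a<a′ , a′<a″)) = inj₂ (to e₁ a<a′ , to e₃ a′<a″)

countMono-sameSteps : ∀ {u v} → SameSteps u v → countMono u ≡ countMono v
countMono-sameSteps []                = refl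
countMono-sameSteps [-]               = refl
countMono-sameSteps (step _ _ [-])    = refl
countMono-sameSteps (step {a} {a′} {b} {b′} e₁ e₂ ss@(step {_} {a″} {_} {b″} e₃ e₄ _))
  with monotone? a a′ a″ | monotone? b b′ b″ | countMono-sameSteps ss
... | yes _  | yes _  | same = cong suc same
... | no  _  | no  _  | same = same
... | yes m  | no ¬m  | _    = contradiction (monotone-transport e₁ e₂ e₃ e₄ m) ¬m
... | no ¬m  | yes m  | _    = contradiction (monotone-transport (⇔-sym e₁) (⇔-sym e₂) (⇔-sym e₃) (⇔-sym e₄) m) ¬m

iso-tail : ∀ {x a s q} → OrderIso (x ∷ s) (a ∷ q) → OrderIso s q
iso-tail (e , iso) = suc-injective e , λ i j → iso (suc i) (suc j)

iso⇒sameSteps : ∀ s q → OrderIso s q → SameSteps (map just s) (map just q)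
iso⇒sameSteps []          []          _       = []
iso⇒sameSteps (x ∷ [])    (a ∷ [])    _       = [-]
iso⇒sameSteps (x ∷ y ∷ s) (a ∷ b ∷ q) i@(_ , iso) =
  step (iso zero (suc zero)) (iso (suc zero) zero) (iso⇒sameSteps (y ∷ s) (b ∷ q) (iso-tail i))
iso⇒sameSteps []          (_ ∷ _)     (() , _)
iso⇒sameSteps (_ ∷ _)     []          (() , _)
iso⇒sameSteps (x ∷ [])    (a ∷ b ∷ q) (() , _)
iso⇒sameSteps (x ∷ y ∷ s) (a ∷ [])    (() , _)

doubling-iso : ∀ s q → OrderIso s q → doubling s ≡ doubling q
doubling-iso []      []      _       = refl
doubling-iso (x ∷ s) (a ∷ q) iso     =
  countMono-sameSteps (step (mk⇔ (λ ()) (λ ())) (mk⇔ _ _) (iso⇒sameSteps (x ∷ s) (a ∷ q) iso))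
doubling-iso []      (_ ∷ _) (() , _)
doubling-iso (_ ∷ _) []      (() , _)

<ᵇ-true : ∀ {a b} → a < b → (a <ᵇ b) ≡ true
<ᵇ-true a<b = to T-≡ (<⇒<ᵇ a<b)

<ᵇ-false : ∀ {a b} → b ≤ a → (a <ᵇ b) ≡ false
<ᵇ-false {a} {b} b≤a with a <ᵇ b | <ᵇ-reflects-< a b
... | true  | ofʸ a<b = contradiction b≤a (<⇒≱ a<b)
... | false | _       = refl

stepUp : Maybe ℕ → ℕ → Bool
stepUp nothing  x = false
stepUp (just a) x = a <ᵇ x

doublingAfter : Maybe ℕ → ℕ → List ℕ → ℕ
doublingAfter a x r = countMono (a ∷ just x ∷ map just r)

agree : Bool → Bool → ℕ
agree true  true  = 1
agree false false = 1
agree _     _     = 0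

agree-≤1 : ∀ b c → agree b c ≤ 1
agree-≤1 true  true  = ≤-refl
agree-≤1 true  false = z≤n
agree-≤1 false true  = z≤n
agree-≤1 false false = ≤-refl

agree-refl : ∀ b → agree b b ≡ 1
agree-refl true  = refl
agree-refl false = refl

agree-adjacent : ∀ b d → agree d b + agree (not b) b ≤ agree b d
agree-adjacent true  true  = ≤-refl
agree-adjacent true  false = ≤-refl
agree-adjacent false true  = ≤-refl
agree-adjacent false false = ≤-refl

agree-triangle : ∀ b c d → agree d c + agree b c ≤ suc (agree b d)
agree-triangle true  true  true  = ≤-refl
agree-triangle true  true  false = ≤-refl
agree-triangle true  false true  = z≤n
agree-triangle true  false false = ≤-refl
agree-triangle false true  true  = ≤-refl
agree-triangle false true  false = z≤n
agree-triangle false false true  = ≤-refl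
agree-triangle false false false = ≤-refl

monotone⇒sameStep : ∀ a x y → Monotone a (just x) (just y) → stepUp a x ≡ (x <ᵇ y)
monotone⇒sameStep nothing  x y (inj₁ (_ , y<x))     = sym (<ᵇ-false (<⇒≤ y<x))
monotone⇒sameStep (just a) x y (inj₁ (x<a , y<x))   = trans (<ᵇ-false (<⇒≤ x<a)) (sym (<ᵇ-false (<⇒≤ y<x)))
monotone⇒sameStep (just a) x y (inj₂ (a<x , x<y))   = trans (<ᵇ-true a<x) (sym (<ᵇ-true x<y))

-- Hence the triple a, x, y can only be doubled if its two steps agree.
doublingAfter-step : ∀ a x y r →
  doublingAfter a x (y ∷ r) ≤ agree (stepUp a x) (x <ᵇ y) + doublingAfter (just x) y r
doublingAfter-step a x y r with monotone? a (just x) (just y)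
... | yes m rewrite monotone⇒sameStep a x y m | agree-refl (x <ᵇ y) = ≤-refl
... | no  _ = m≤n+m _ _

shiftDir : Bool → List ℕ → Bool
shiftDir b []       = b
shiftDir b (_ ∷ us) = shiftDir (not b) us

alt-suffix : ∀ b us ys → Alt b (us ++ ys) → Alt (shiftDir b us) ys
alt-suffix b []       ys alt = alt
alt-suffix b (u ∷ us) ys alt = alt-suffix (not b) us ys (alt-tail b u (us ++ ys) alt)

alt-head : ∀ b x y r → Alt b (x ∷ y ∷ r) → (x <ᵇ y) ≡ b
alt-head true  x y r (x<y , _) = <ᵇ-true x<y
alt-head false x y r (y<x , _) = <ᵇ-false (<⇒≤ y<x)

-- The cost of jumping from x over the entries us to y in an alternating
-- sequence: a jump of length 1 must follow the current direction b, a jump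
-- of length 2 arrives in direction b again, longer jumps are unconstrained.
gap-bound : ∀ b d x us y vs → Alt b (x ∷ us ++ y ∷ vs) →
  agree d (x <ᵇ y) + agree (shiftDir (not b) us) (x <ᵇ y) ≤ length us + agree b d
gap-bound b d x []             y vs alt rewrite alt-head b x y vs alt = agree-adjacent b d
gap-bound b d x (_ ∷ [])       y vs _   rewrite not-involutive b     = agree-triangle b (x <ᵇ y) d
gap-bound b d x (_ ∷ _ ∷ _)    y vs _   =
  ≤-trans (+-mono-≤ (agree-≤1 d (x <ᵇ y)) (agree-≤1 _ (x <ᵇ y))) (s≤s (s≤s z≤n))

⊆-locate : ∀ {y : ℕ} {r w} → (y ∷ r) ⊆ w → ∃[ us ] ∃[ vs ] (w ≡ us ++ y ∷ vs × r ⊆ vs)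
⊆-locate (z ∷ʳ τ) with ⊆-locate τ
... | us , vs , refl , τ′ = z ∷ us , vs , refl , τ′
⊆-locate (refl ∷ τ) = [] , _ , refl , τ

-- If x ∷ w alternates starting in direction b and r is a subsequence of w,
-- every doubled position of a, x, r costs an extra entry of w, up to the
-- correction agree b (stepUp a x) at x itself (telescoping along r).
run-bound : ∀ b a x w r → Alt b (x ∷ w) → r ⊆ w →
            length r + doublingAfter a x r ≤ length w + agree b (stepUp a x)
run-bound b a x w []      _   _ = z≤n
run-bound b a x w (y ∷ r) alt τ with ⊆-locate τ
... | us , vs , refl , τ′ = begin
  suc (length r + doublingAfter a x (y ∷ r))
    ≤⟨ s≤s (+-monoʳ-≤ (length r) (doublingAfter-step a x y r)) ⟩
  suc (length r + (jump + doublingAfter (just x) y r))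
    ≡⟨ cong suc (+-exchange (length r) jump _) ⟩
  suc (jump + (length r + doublingAfter (just x) y r))
    ≤⟨ s≤s (+-monoʳ-≤ jump rest) ⟩
  suc (jump + (length vs + agree b′ (x <ᵇ y)))
    ≡⟨ cong suc (+-exchange jump (length vs) _) ⟩
  suc (length vs + (jump + agree b′ (x <ᵇ y)))
    ≤⟨ s≤s (+-monoʳ-≤ (length vs) (gap-bound b (stepUp a x) x us y vs alt)) ⟩
  suc (length vs + (length us + agree b (stepUp a x)))
    ≡⟨ regroup (length us) (length vs) _ ⟩
  (length us + suc (length vs)) + agree b (stepUp a x)
    ≡⟨ cong (_+ agree b (stepUp a x)) (length-++ us) ⟨
  length (us ++ y ∷ vs) + agree b (stepUp a x)
    ∎
  where
  open ≤-Reasoning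
  jump = agree (stepUp a x) (x <ᵇ y)
  b′   = shiftDir (not b) us
  rest : length r + doublingAfter (just x) y r ≤ length vs + agree b′ (x <ᵇ y)
  rest = run-bound b′ (just x) y vs r (alt-suffix b (x ∷ us) (y ∷ vs) alt) τ′
  +-exchange : ∀ m n k → m + (n + k) ≡ n + (m + k)
  +-exchange = solve-∀
  regroup : ∀ u v d → suc (v + (u + d)) ≡ (u + suc v) + d
  regroup = solve-∀

start-bound : ∀ us → agree (shiftDir true us) false ≤ length us
start-bound []       = z≤n
start-bound (_ ∷ us) = ≤-trans (agree-≤1 _ false) (s≤s z≤n)

subsequence-bound : ∀ w s → Alt true w → s ⊆ w → length s + doubling s ≤ length w
subsequence-bound w []      _   _ = z≤n
subsequence-bound w (x ∷ r) alt τ with ⊆-locate τ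
... | us , vs , refl , τ′ = begin
  suc (length r + doubling (x ∷ r))
    ≤⟨ s≤s (run-bound b nothing x vs r (alt-suffix true us (x ∷ vs) alt) τ′) ⟩
  suc (length vs + agree b false)
    ≤⟨ s≤s (+-monoʳ-≤ (length vs) (start-bound us)) ⟩
  suc (length vs + length us)
    ≡⟨ cong suc (trans (+-comm (length vs) (length us)) (sym (length-++ us))) ⟩
  suc (length (us ++ vs))
    ≡⟨ length-++-sucʳ us x vs ⟨
  length (us ++ x ∷ vs)
    ∎
  where
  open ≤-Reasoning
  b = shiftDir true us

lower-bound : ∀ w q → Up w → Contains w q → length q + doubling q ≤ length w
lower-bound w q up (s , τ , iso) =
  subst₂ (λ k t → k + t ≤ length w) (proj₁ iso) (doubling-iso s q iso)
         (subsequence-bound w s (up⇒alt w up) τ)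

-- Slots: each pattern entry x owns the three consecutive values 3x, 3x+1, 3x+2.
slot : ℕ → ℕ → ℕ
slot x c = x * 3 + c

slot-< : ∀ {x y} c d → x < y → c ≤ 2 → slot x c < slot y d
slot-< {x} {y} c d x<y c≤2 = begin-strict
  x * 3 + c  ≤⟨ +-monoʳ-≤ (x * 3) c≤2 ⟩
  x * 3 + 2  <⟨ +-monoʳ-< (x * 3) ≤-refl ⟩
  x * 3 + 3  ≡⟨ +-comm (x * 3) 3 ⟩
  suc x * 3  ≤⟨ *-monoˡ-≤ 3 x<y ⟩
  y * 3      ≤⟨ m≤m+n (y * 3) d ⟩
  y * 3 + d  ∎
  where open ≤-Reasoning

slot-owner : ∀ x c → c < 3 → slot x c / 3 ≡ x
slot-owner x c c<3 = begin
  (x * 3 + c) / 3      ≡⟨ +-distrib-/-∣ˡ c (n∣m*n x) ⟩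
  x * 3 / 3 + c / 3    ≡⟨ cong₂ _+_ (m*n/n≡m x 3) (m<n⇒m/n≡0 c<3) ⟩
  x + 0                ≡⟨ +-identityʳ x ⟩
  x                    ∎
  where open ≡-Reasoning

-- centre x represents the pattern entry x; detour c x is the neighbouring
-- value on the far side from a step in direction c.
centre : ℕ → ℕ
centre x = slot x 1

detour : Bool → ℕ → ℕ
detour true  x = slot x 0
detour false x = slot x 2

detour-owner : ∀ c x → detour c x / 3 ≡ x
detour-owner true  x = slot-owner x 0 (s≤s z≤n)
detour-owner false x = slot-owner x 2 (s≤s (s≤s (s≤s z≤n)))

centre-increasing : ∀ {S} → IncreasingOn centre S
centre-increasing _ _ x<y = slot-< 1 1 x<y (s≤s z≤n)

step-between : ∀ x y → x ≢ y → Step (x <ᵇ y) x y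
step-between x y x≢y with x <ᵇ y | <ᵇ-reflects-< x y
... | true  | ofʸ x<y = x<y
... | false | ofⁿ x≮y = ≤∧≢⇒< (≮⇒≥ x≮y) (x≢y ∘ sym)

centre-step : ∀ c x y → Step c x y → Step c (centre x) (centre y)
centre-step true  x y x<y = slot-< 1 1 x<y (s≤s z≤n)
centre-step false x y y<x = slot-< 1 1 y<x (s≤s z≤n)

detour-out : ∀ c x → Step (not c) (centre x) (detour c x)
detour-out true  x = +-monoʳ-< (x * 3) (s≤s z≤n)
detour-out false x = +-monoʳ-< (x * 3) (s≤s (s≤s z≤n))

detour-in : ∀ c x y → Step c x y → Step c (detour c x) (centre y)
detour-in true  x y x<y = slot-< 0 1 x<y z≤n
detour-in false x y y<x = slot-< 1 2 y<x (s≤s z≤n)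

step-≢ : ∀ c {x y} → Step c x y → x ≢ y
step-≢ true  x<y = <⇒≢ x<y
step-≢ false y<x = <⇒≢ y<x ∘ sym

alt-detour : ∀ c x y t → Step c x y → Alt (not c) (centre y ∷ t) →
             Alt (not c) (centre x ∷ detour c x ∷ centre y ∷ t)
alt-detour true  x y t s alt = detour-out true x  , detour-in true x y s  , alt
alt-detour false x y t s alt = detour-out false x , detour-in false x y s , alt

alt-direct : ∀ c x y t → Step c x y → Alt (not c) (centre y ∷ t) →
             Alt (not (not c)) (centre x ∷ centre y ∷ t)
alt-direct true  x y t s alt = centre-step true x y s  , alt
alt-direct false x y t s alt = centre-step false x y s , alt

turn : ∀ a x y → a ≢ just x → x ≢ y → ¬ Monotone a (just x) (just y) → stepUp a x ≡ not (x <ᵇ y)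
turn nothing x y _ x≢y ¬mono with x <ᵇ y | <ᵇ-reflects-< x y
... | true  | _        = refl
... | false | ofⁿ x≮y  = contradiction (inj₁ (tt , ≤∧≢⇒< (≮⇒≥ x≮y) (x≢y ∘ sym))) ¬mono
turn (just a) x y a≢x x≢y ¬mono with a <ᵇ x | <ᵇ-reflects-< a x | x <ᵇ y | <ᵇ-reflects-< x y
... | true  | ofʸ a<x | true  | ofʸ x<y = contradiction (inj₂ (a<x , x<y)) ¬mono
... | true  | _       | false | _       = refl
... | false | _       | true  | _       = refl
... | false | ofⁿ a≮x | false | ofⁿ x≮y = contradiction
  (inj₁ (≤∧≢⇒< (≮⇒≥ a≮x) (a≢x ∘ cong just ∘ sym) , ≤∧≢⇒< (≮⇒≥ x≮y) (x≢y ∘ sym))) ¬mono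

padding : Bool → Bool → ℕ → List ℕ
padding true  c x = detour c x ∷ []
padding false c x = []

padLength : Bool → ℕ
padLength true  = 1
padLength false = 0

mutual
  realise : Bool → Maybe ℕ → ℕ → List ℕ → List ℕ
  realise pad a x r = centre x ∷ afterCentre pad a x r

  afterCentre : Bool → Maybe ℕ → ℕ → List ℕ → List ℕ
  afterCentre pad a x []      = padding pad (stepUp a x) x
  afterCentre pad a x (y ∷ r) with monotone? a (just x) (just y)
  ... | yes _ = detour (x <ᵇ y) x ∷ realise pad (just x) y r
  ... | no  _ = realise pad (just x) y r

realise-length : ∀ pad a x r →
  length (realise pad a x r) ≡ suc (length r + doublingAfter a x r) + padLength pad
realise-length true  a x [] = refl
realise-length false a x [] = refl
realise-length pad a x (y ∷ r) with monotone? a (just x) (just y) | realise-length pad (just x) y r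
... | yes _ | len = cong suc (trans (cong suc len) (regroup (length r) _ (padLength pad)))
  where
  regroup : ∀ k t p → suc (suc (k + t) + p) ≡ suc k + suc t + p
  regroup = solve-∀
... | no  _ | len = cong suc len

mutual
  realise-centres : ∀ pad a x r → map centre (x ∷ r) ⊆ realise pad a x r
  realise-centres pad a x r = refl ∷ afterCentre-centres pad a x r

  afterCentre-centres : ∀ pad a x r → map centre r ⊆ afterCentre pad a x r
  afterCentre-centres pad a x []      = minimum _
  afterCentre-centres pad a x (y ∷ r) with monotone? a (just x) (just y)
  ... | yes _ = _ ∷ʳ realise-centres pad (just x) y r
  ... | no  _ = realise-centres pad (just x) y r

mutual
  realise-owners : ∀ pad a x r {z} → z ∈ realise pad a x r → z / 3 ∈ x ∷ r
  realise-owners pad a x r (here refl) = here (slot-owner x 1 (s≤s (s≤s z≤n)))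
  realise-owners pad a x r (there z∈) = afterCentre-owners pad a x r z∈

  afterCentre-owners : ∀ pad a x r {z} → z ∈ afterCentre pad a x r → z / 3 ∈ x ∷ r
  afterCentre-owners true a x [] (here refl) = here (detour-owner (stepUp a x) x)
  afterCentre-owners pad a x (y ∷ r) z∈ with monotone? a (just x) (just y) | z∈
  ... | yes _ | here refl = here (detour-owner (x <ᵇ y) x)
  ... | yes _ | there z∈′ = there (realise-owners pad (just x) y r z∈′)
  ... | no  _ | z∈′       = there (realise-owners pad (just x) y r z∈′)

later-fresh : ∀ pad x y r {z} → x ∉ y ∷ r → z / 3 ≡ x → z ∉ realise pad (just x) y r
later-fresh pad x y r x∉ refl z∈ = x∉ (realise-owners pad (just x) y r z∈)

centre-fresh : ∀ pad a x r → x ∉ r → centre x ∉ afterCentre pad a x r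
centre-fresh true a x [] _ (here c≡d) = step-≢ _ (detour-out (stepUp a x) x) c≡d
centre-fresh pad a x (y ∷ r) x∉ c∈ with monotone? a (just x) (just y) | c∈
... | yes _ | here c≡d = step-≢ _ (detour-out (x <ᵇ y) x) c≡d
... | yes _ | there c∈′ = later-fresh pad x y r x∉ (slot-owner x 1 (s≤s (s≤s z≤n))) c∈′
... | no  _ | c∈′       = later-fresh pad x y r x∉ (slot-owner x 1 (s≤s (s≤s z≤n))) c∈′

mutual
  realise-unique : ∀ pad a x r → Unique (x ∷ r) → Unique (realise pad a x r)
  realise-unique pad a x r u@(_ ∷ ur) =
    ¬Any⇒All¬ _ (centre-fresh pad a x r (Unique[x∷xs]⇒x∉xs u)) ∷ afterCentre-unique pad a x r u

  afterCentre-unique : ∀ pad a x r → Unique (x ∷ r) → Unique (afterCentre pad a x r)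
  afterCentre-unique true  a x [] _ = [] ∷ []
  afterCentre-unique false a x [] _ = []
  afterCentre-unique pad a x (y ∷ r) u@(_ ∷ ur) with monotone? a (just x) (just y)
  ... | yes _ = ¬Any⇒All¬ _ (later-fresh pad x y r (Unique[x∷xs]⇒x∉xs u) (detour-owner (x <ᵇ y) x))
                ∷ realise-unique pad (just x) y r ur
  ... | no  _ = realise-unique pad (just x) y r ur

realise-alt : ∀ pad a x r → a ≢ just x → Unique (x ∷ r) → Alt (not (stepUp a x)) (realise pad a x r)
realise-alt true  a x [] _ _ = detour-out (stepUp a x) x , tt
realise-alt false a x [] _ _ = tt
realise-alt pad a x (y ∷ r) a≢x ((x≢y ∷ _) ∷ ur) with monotone? a (just x) (just y)
... | yes mono rewrite monotone⇒sameStep a x y mono =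
  alt-detour (x <ᵇ y) x y _ (step-between x y x≢y) (realise-alt pad (just x) y r (x≢y ∘ just-injective) ur)
... | no ¬mono rewrite turn a x y a≢x x≢y ¬mono =
  alt-direct (x <ᵇ y) x y _ (step-between x y x≢y) (realise-alt pad (just x) y r (x≢y ∘ just-injective) ur)

witness : ∀ p pad → Unique p →
  ∃[ w ] (InS (length p + doubling p + padLength pad) w × Up w × Contains w p)
witness []      true  _ = 0 ∷ [] , ↭-refl , tt , [] , (0 ∷ʳ []) , refl , (λ ())
witness []      false _ = []     , ↭-refl , tt , [] , []        , refl , (λ ())
witness (x ∷ r) pad u = map (rank v) v , perm , up , map (rank v ∘ centre) (x ∷ r) , sub , iso
  where
  v = realise pad nothing x r
  perm : InS (length (x ∷ r) + doubling (x ∷ r) + padLength pad) (map (rank v) v)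
  perm = subst (λ n → InS n (map (rank v) v)) (realise-length pad nothing x r)
               (standardise v (realise-unique pad nothing x r u))
  up : Up (map (rank v) v)
  up = alt⇒up _ (alt-map true v (rank-increasing v) (realise-alt pad nothing x r (λ ()) u))
  sub : map (rank v ∘ centre) (x ∷ r) ⊆ map (rank v) v
  sub = subst (_⊆ map (rank v) v) (sym (map-∘ (x ∷ r))) (map⁺ (rank v) (realise-centres pad nothing x r))
  iso : OrderIso (map (rank v ∘ centre) (x ∷ r)) (x ∷ r)
  iso = increasing-iso (x ∷ r) (increasing-∘ centre-increasing (rank-increasing v)
          (λ y∈ → ⊆-lookup (realise-centres pad nothing x r) (∈-map⁺ centre y∈)))

perm-length : ∀ {n w} → InS n w → length w ≡ n
perm-length {n} w↭ = trans (↭-length w↭) (length-upTo n)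

-- If all alternating permutations of length N avoid q but one contains p,
-- then A_N(p) is a proper subset of A_N(q), so |A_N(p)| < |A_N(q)|.
proper-subset-< : ∀ N p q → (∀ w → InS N w → Up w → Avoids w q) →
  ∃[ w ] (InS N w × Up w × Contains w p) →
  ∀ α β → CardA N p α → CardA N q β → α < β
proper-subset-< N p q avoid (w , w∈S , up , w⊇p) α β (Lp , uLp , ∈Lp , refl) (Lq , _ , ∈Lq , refl) =
  unique-length-< Lp Lq uLp Lp⊆Lq (from (∈Lq w) (w∈S , up , avoid w w∈S up))
                  (λ w∈Lp → proj₂ (proj₂ (to (∈Lp w) w∈Lp)) w⊇p)
  where
  Lp⊆Lq : ∀ {v} → v ∈ Lp → v ∈ Lq
  Lp⊆Lq {v} v∈ with to (∈Lp v) v∈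
  ... | v∈S , v-up , _ = from (∈Lq v) (v∈S , v-up , avoid v v∈S v-up)

-- ℓ(p) = |p| + t(p): by lower-bound and witness, the least length of an
-- alternating permutation containing p.
minLength : List ℕ → ℕ
minLength p = length p + doubling p

separating-length : ∀ N p q → Unique p → (∃[ pad ] N ≡ minLength p + padLength pad) →
  N < minLength q → ∀ α β → CardA N p α → CardA N q β → α < β
separating-length N p q up (pad , refl) N<ℓq = proper-subset-< N p q avoid (witness p pad up)
  where
  avoid : ∀ w → InS N w → Up w → Avoids w q
  avoid w w∈S w-up w⊇q =
    <⇒≱ N<ℓq (subst (minLength q ≤_) (perm-length w∈S) (lower-bound w q w-up w⊇q))

-- A class of lengths (the even or the odd ones), enumerated by len, where
-- first a indexes its least member ≥ a, which is a or a + 1.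
record LengthClass : Set where
  field
    len        : ℕ → ℕ
    first      : ℕ → ℕ
    first-near : ∀ a → ∃[ pad ] len (first a) ≡ a + padLength pad
    first-<    : ∀ a b → first a < first b → len (first a) < b

open LengthClass

separate : (C : LengthClass) → ∀ p q → Unique p → Unique q →
  ¬ (first C (minLength p) ≡ first C (minLength q)) →
  ∃[ m ] (∀ α β → CardA (len C m) p α → CardA (len C m) q β → α ≢ β)
separate C p q up uq ≢first with <-cmp (first C (minLength p)) (first C (minLength q))
... | tri< lt _ _ = _ , λ α β α-card β-card →
  <⇒≢ (separating-length _ p q up (first-near C _) (first-< C _ _ lt) α β α-card β-card)
... | tri≈ _ eq _ = contradiction eq ≢first
... | tri> _ _ gt = _ , λ α β α-card β-card →
  ≢-sym (<⇒≢ (separating-length _ q p uq (first-near C _) (first-< C _ _ gt) β α β-card α-card))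

twice-ceil : ∀ a → ∃[ pad ] 2 * ⌈ a /2⌉ ≡ a + padLength pad
twice-ceil zero          = false , refl
twice-ceil (suc zero)    = true  , refl
twice-ceil (suc (suc a)) with twice-ceil a
... | pad , eq = pad , trans (*-suc 2 ⌈ a /2⌉) (cong (2 +_) eq)

twice-ceil-< : ∀ a b → ⌈ a /2⌉ < ⌈ b /2⌉ → 2 * ⌈ a /2⌉ < b
twice-ceil-< a b lt with twice-ceil b
... | pad , eq = s≤s⁻¹ (begin
  suc (suc (2 * ⌈ a /2⌉)) ≡⟨ *-suc 2 ⌈ a /2⌉ ⟨
  2 * suc ⌈ a /2⌉         ≤⟨ *-monoʳ-≤ 2 lt ⟩
  2 * ⌈ b /2⌉             ≡⟨ eq ⟩
  b + padLength pad       ≤⟨ +-monoʳ-≤ b (padLength≤1 pad) ⟩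
  b + 1                   ≡⟨ +-comm b 1 ⟩
  suc b                   ∎)
  where
  open ≤-Reasoning
  padLength≤1 : ∀ pad → padLength pad ≤ 1
  padLength≤1 true  = ≤-refl
  padLength≤1 false = z≤n

evens : LengthClass
evens = record { len = 2 *_ ; first = ⌈_/2⌉ ; first-near = twice-ceil ; first-< = twice-ceil-< }

odds : LengthClass
odds = record { len = λ m → 1 + 2 * m ; first = λ a → ⌈ (a ∸ 1) /2⌉ ; first-near = near ; first-< = below }
  where
  near : ∀ a → ∃[ pad ] 1 + 2 * ⌈ (a ∸ 1) /2⌉ ≡ a + padLength pad
  near zero    = true , refl
  near (suc a) with twice-ceil a
  ... | pad , eq = pad , cong suc eq
  below : ∀ a b → ⌈ (a ∸ 1) /2⌉ < ⌈ (b ∸ 1) /2⌉ → 1 + 2 * ⌈ (a ∸ 1) /2⌉ < b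
  below a zero    ()
  below a (suc b) lt = s≤s (twice-ceil-< (a ∸ 1) b lt)

corollary5p5 : (p q : List ℕ) → IsPerm p → IsPerm q →
    (¬ (⌈ (length p + doubling p) /2⌉ ≡ ⌈ (length q + doubling q) /2⌉) →
      ∃[ m ] (∀ a b → CardA (2 * m) p a → CardA (2 * m) q b → a ≢ b))
    × (¬ (⌈ (length p + doubling p ∸ 1) /2⌉ ≡ ⌈ (length q + doubling q ∸ 1) /2⌉) →
      ∃[ m ] (∀ a b → CardA (1 + 2 * m) p a → CardA (1 + 2 * m) q b → a ≢ b))
corollary5p5 p q p-perm q-perm = separate evens p q up uq , separate odds p q up uq
  where
  up = perm-unique p-perm
  uq = perm-unique q-perm
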